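{- Let $\mathfrak M=(X,1,\curlywedge,s,V)$ be a selection L-model. Then for every formula $\phi$, the truth set $[\![\phi]\!]=\{x\in X:\mathfrak M,x\Vdash\phi\}$ is a filter of $(X,1,\curlywedge)$.
   Context: Formulas: $\phi::=p\mid\top\mid\bot\mid\phi\wedge\phi\mid\phi\vee\phi\mid\phi\Rightarrow\phi$. A meet-semilattice $(X,1,\curlywedge)$ has top $1$ and order $x\preccurlyeq y$ iff $x\curlywedge y=x$; a filter is an upward closed subset closed under finite meets (in particular containing $1$); $\mathcal F(X)$ is the set of filters. A selection L-frame is $(X,1,\curlywedge,s)$ with $s:X\times\mathcal F(X)\to\mathcal F(X)$ such that for all $x,y,z$ and filters $a$: $s(1,a)=\{1\}$; $x\preccurlyeq y$ implies $s(y,a)\subseteq s(x,a)$; if $z\in s(x\curlywedge y,a)$ there are $u\in s(x,a)$, $v\in s(y,a)$ with $u\curlywedge v\preccurlyeq z$. A selection L-model adds a valuation $V$ assigning a filter to each letter. Truth: $x\Vdash p$ iff $x\in V(p)$; $\top$ always; $x\Vdash\bot$ iff $x=1$; $x\Vdash\phi\wedge\psi$ iff both; $x\Vdash\phi\vee\psi$ iff there are $y,z$ with $y\Vdash\phi$, $z\Vdash\psi$, $y\curlywedge z\preccurlyeq x$; $x\Vdash\phi\Rightarrow\psi$ iff $s(x,[\![\phi]\!])\subseteq[\![\psi]\!]$. -}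

module Defs where

open import Level using (0ℓ)
open import Data.Product using (Σ; ∃; _×_; _,_)
open import Data.Unit using (⊤)
open import Relation.Unary using (Pred; _∈_; _⊆_)
open import Relation.Binary.PropositionalEquality using (_≡_)

data Formula (Prop : Set) : Set where
  var  : Prop → Formula Prop
  ⊤ᶠ   : Formula Prop
  ⊥ᶠ   : Formula Prop
  _∧ᶠ_ : Formula Prop → Formula Prop → Formula Prop
  _∨ᶠ_ : Formula Prop → Formula Prop → Formula Prop
  _⇒ᶠ_ : Formula Prop → Formula Prop → Formula Prop

record MeetSL : Set₁ where
  field
    X      : Set
    one    : X
    _⋏_    : X → X → X
    ⋏-assoc : ∀ x y z → (x ⋏ y) ⋏ z ≡ x ⋏ (y ⋏ z)
    ⋏-comm  : ∀ x y → x ⋏ y ≡ y ⋏ x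
    ⋏-idem  : ∀ x → x ⋏ x ≡ x
    ⋏-one   : ∀ x → x ⋏ one ≡ x

  infixr 7 _⋏_
  infix 4 _≼_

  _≼_ : X → X → Set
  x ≼ y = x ⋏ y ≡ x

  record IsFilter (a : Pred X 0ℓ) : Set where
    field
      upward  : ∀ {x y} → x ≼ y → x ∈ a → y ∈ a
      has-one : one ∈ a
      meet    : ∀ {x y} → x ∈ a → y ∈ a → (x ⋏ y) ∈ a

-- A selection L-frame.  The selection function is typed on all subsets,
-- but all requirements (including that the output is a filter) are only
-- imposed on filter arguments.
record SelectionFrame : Set₁ where
  field
    L : MeetSL
  open MeetSL L public
  field
    s : X → Pred X 0ℓ → Pred X 0ℓ
    s-filter : ∀ x a → IsFilter a → IsFilter (s x a)
    s-one    : ∀ a → IsFilter a → ∀ z → z ∈ s one a → z ≡ one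
    s-one'   : ∀ a → IsFilter a → one ∈ s one a
    s-antitone : ∀ {x y} a → IsFilter a → x ≼ y → s y a ⊆ s x a
    s-meet   : ∀ x y a → IsFilter a → ∀ {z} → z ∈ s (x ⋏ y) a →
               Σ X λ u → Σ X λ v → u ∈ s x a × v ∈ s y a × (u ⋏ v) ≼ z

record SelectionModel (Prop : Set) : Set₁ where
  field
    F : SelectionFrame
  open SelectionFrame F public
  field
    V : Prop → Pred X 0ℓ
    V-filter : ∀ p → IsFilter (V p)

  ⟦_⟧ : Formula Prop → Pred X 0ℓ
  ⟦ var p ⟧ x = x ∈ V p
  ⟦ ⊤ᶠ ⟧ x = ⊤
  ⟦ ⊥ᶠ ⟧ x = x ≡ one
  ⟦ φ ∧ᶠ ψ ⟧ x = ⟦ φ ⟧ x × ⟦ ψ ⟧ x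
  ⟦ φ ∨ᶠ ψ ⟧ x = Σ X λ y → Σ X λ z → ⟦ φ ⟧ y × ⟦ ψ ⟧ z × (y ⋏ z) ≼ x
  ⟦ φ ⇒ᶠ ψ ⟧ x = s x ⟦ φ ⟧ ⊆ ⟦ ψ ⟧

-- Induction on φ: each connective builds a filter from filters.  For ⇒ the three frame conditions on s are exactly what
-- is needed: antitonicity gives upward closure, s(1,a) = {1} puts 1 in the set,
-- and the splitting condition on s(x ⋏ y, a) gives closure under meets.
module Submission where

open import Defs
open import Level using (0ℓ)
open import Data.Product using (Σ; _×_; _,_)
open import Data.Unit using (tt)
open import Relation.Unary using (Pred; U; _∩_; _⊆_; _∈_)
open import Relation.Binary.PropositionalEquality
  using (_≡_; refl; sym; trans; cong; cong₂; subst; module ≡-Reasoning)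

module _ (L : MeetSL) where
  open MeetSL L
  open ≡-Reasoning

  ⋏-interchange : ∀ a b c d → (a ⋏ b) ⋏ (c ⋏ d) ≡ (a ⋏ c) ⋏ (b ⋏ d)
  ⋏-interchange a b c d = begin
    (a ⋏ b) ⋏ (c ⋏ d) ≡⟨ ⋏-assoc a b (c ⋏ d) ⟩
    a ⋏ (b ⋏ (c ⋏ d)) ≡⟨ cong (a ⋏_) (sym (⋏-assoc b c d)) ⟩
    a ⋏ ((b ⋏ c) ⋏ d) ≡⟨ cong (λ t → a ⋏ (t ⋏ d)) (⋏-comm b c) ⟩
    a ⋏ ((c ⋏ b) ⋏ d) ≡⟨ cong (a ⋏_) (⋏-assoc c b d) ⟩
    a ⋏ (c ⋏ (b ⋏ d)) ≡⟨ sym (⋏-assoc a c (b ⋏ d)) ⟩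
    (a ⋏ c) ⋏ (b ⋏ d) ∎

  ≼-trans : ∀ {x y z} → x ≼ y → y ≼ z → x ≼ z
  ≼-trans {x} {y} {z} x≼y y≼z = begin
    x ⋏ z       ≡⟨ cong (_⋏ z) (sym x≼y) ⟩
    (x ⋏ y) ⋏ z ≡⟨ ⋏-assoc x y z ⟩
    x ⋏ (y ⋏ z) ≡⟨ cong (x ⋏_) y≼z ⟩
    x ⋏ y       ≡⟨ x≼y ⟩
    x           ∎

  ⋏-mono-≼ : ∀ {a b c d} → a ≼ b → c ≼ d → a ⋏ c ≼ b ⋏ d
  ⋏-mono-≼ {a} {b} {c} {d} a≼b c≼d =
    trans (⋏-interchange a c b d) (cong₂ _⋏_ a≼b c≼d)

  one-maximal : ∀ {y} → one ≼ y → y ≡ one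
  one-maximal {y} one≼y = begin
    y       ≡⟨ sym (⋏-one y) ⟩
    y ⋏ one ≡⟨ ⋏-comm y one ⟩
    one ⋏ y ≡⟨ one≼y ⟩
    one     ∎

  U-isFilter : IsFilter U
  U-isFilter = record { upward = λ _ _ → tt ; has-one = tt ; meet = λ _ _ → tt }

  one-isFilter : IsFilter (_≡ one)
  one-isFilter = record
    { upward  = λ { x≼y refl → one-maximal x≼y }
    ; has-one = refl
    ; meet    = λ { refl refl → ⋏-idem one }
    }

  ∩-isFilter : ∀ {a b} → IsFilter a → IsFilter b → IsFilter (a ∩ b)
  ∩-isFilter fa fb = record
    { upward  = λ x≼y (xa , xb) → upward fa x≼y xa , upward fb x≼y xb
    ; has-one = has-one fa , has-one fb
    ; meet    = λ (xa , xb) (ya , yb) → meet fa xa ya , meet fb xb yb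
    }
    where open IsFilter

  -- The filter generated by a ∪ b, for filters a and b.
  _⊻_ : Pred X 0ℓ → Pred X 0ℓ → Pred X 0ℓ
  (a ⊻ b) x = Σ X λ y → Σ X λ z → a y × b z × y ⋏ z ≼ x

  ⊻-isFilter : ∀ {a b} → IsFilter a → IsFilter b → IsFilter (a ⊻ b)
  ⊻-isFilter fa fb = record
    { upward  = λ x≼x′ (y , z , ya , zb , y⋏z≼x) →
                  y , z , ya , zb , ≼-trans y⋏z≼x x≼x′
    ; has-one = one , one , has-one fa , has-one fb , ⋏-one (one ⋏ one)
    ; meet    = λ {x} {x′} (y , z , ya , zb , y⋏z≼x) (y′ , z′ , y′a , z′b , y′⋏z′≼x′) →
                  y ⋏ y′ , z ⋏ z′ , meet fa ya y′a , meet fb zb z′b ,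
                  subst (_≼ x ⋏ x′) (⋏-interchange y z y′ z′) (⋏-mono-≼ y⋏z≼x y′⋏z′≼x′)
    }
    where open IsFilter

module _ (F : SelectionFrame) where
  open SelectionFrame F

  implication-isFilter : ∀ {a b} → IsFilter a → IsFilter b →
                         IsFilter (λ x → s x a ⊆ b)
  implication-isFilter {a} {b} fa fb = record
    { upward  = λ x≼y sxa⊆b z∈sya → sxa⊆b (s-antitone a fa x≼y z∈sya)
    ; has-one = λ {z} z∈s1a → subst b (sym (s-one a fa z z∈s1a)) (has-one fb)
    ; meet    = λ {x} {y} sxa⊆b sya⊆b z∈s → split sxa⊆b sya⊆b (s-meet x y a fa z∈s)
    }
    where
    open IsFilter
    split : ∀ {x y z} → s x a ⊆ b → s y a ⊆ b →
            Σ X (λ u → Σ X λ v → u ∈ s x a × v ∈ s y a × u ⋏ v ≼ z) → z ∈ b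
    split sxa⊆b sya⊆b (u , v , u∈sxa , v∈sya , u⋏v≼z) =
      upward fb u⋏v≼z (meet fb (sxa⊆b u∈sxa) (sya⊆b v∈sya))

module _ {Prop : Set} (M : SelectionModel Prop) where
  open SelectionModel M

  ⟦⟧-isFilter : ∀ φ → IsFilter ⟦ φ ⟧
  ⟦⟧-isFilter (var p)  = V-filter p
  ⟦⟧-isFilter ⊤ᶠ       = U-isFilter L
  ⟦⟧-isFilter ⊥ᶠ       = one-isFilter L
  ⟦⟧-isFilter (φ ∧ᶠ ψ) = ∩-isFilter L (⟦⟧-isFilter φ) (⟦⟧-isFilter ψ)
  ⟦⟧-isFilter (φ ∨ᶠ ψ) = ⊻-isFilter L (⟦⟧-isFilter φ) (⟦⟧-isFilter ψ)
  ⟦⟧-isFilter (φ ⇒ᶠ ψ) = implication-isFilter F (⟦⟧-isFilter φ) (⟦⟧-isFilter ψ)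

proposition3p11 : {Prop : Set} (M : SelectionModel Prop) (φ : Formula Prop) →
    SelectionModel.IsFilter M (SelectionModel.⟦_⟧ M φ)
proposition3p11 = ⟦⟧-isFilter
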